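{- Let $A$ be a closed type of the guarded $\lambda$-calculus. In the (constant) context $x,y:\blacksquare A$, the formula $\square(\mathsf{unbox}\,x=_A\mathsf{unbox}\,y)\Rightarrow x=_{\blacksquare A}y$ is valid in the internal logic of the topos of trees.
   Context: The topos of trees $\mathcal S$: objects $X$ are families of sets $X_1,X_2,\dots$ with restriction maps $r^X_i:X_{i+1}\to X_i$ (composites written $\restriction_m:X_n\to X_m$ for $m\le n$); morphisms natural families of functions. Its subobject classifier $\Omega$ has $\Omega_n=\{0,1,\dots,n\}$ with restriction $k\mapsto\min(n,k)$ from $\Omega_{n+1}$ to $\Omega_n$ ($n$ being "true" at stage $n$). Types of the guarded $\lambda$-calculus denote $\mathcal S$-objects; $[\![\blacksquare A]\!]=\Delta(\mathrm{Hom}_{\mathcal S}(1,[\![A]\!]))$ (the constant object on global elements), and $\mathsf{unbox}:[\![\blacksquare A]\!]\to[\![A]\!]$ has $\mathsf{unbox}_i(x)=x_i$. The modality $\square$ ("always") on the poset $\mathrm{Sub}(X)$ of subobjects of $X$ is the right adjoint of the join-preserving map $\neg\neg$; concretely, for $x\in X_m$ let $\mathrm{height}_X(x)$ be the largest $n\ge m$ such that some $y\in X_n$ has $\restriction_m(y)=x$ (or $\infty$ if none is largest), and for a subobject $Y$ of $X$ the characteristic map of $\square Y$ is $(\chi_{\square Y})_n(x)=(\chi_Y)_n(x)$ if $\mathrm{height}_Y(x)=\mathrm{height}_X(x)$ and $0$ otherwise. A formula in context is valid if its interpretation is the top subobject. -}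

module Defs where

open import Data.Nat using (ℕ; zero; suc; _≤′_; _<′_; ≤′-refl; ≤′-step)
open import Data.Product using (Σ; _×_; _,_; proj₁; proj₂)
open import Relation.Binary.PropositionalEquality using (_≡_)
open import Relation.Nullary using (¬_)

-- Objects of the topos of trees S.
-- CONVENTION: stage index n : ℕ stands for the paper's stage n+1,
-- i.e. Ob X 0 = X_1, Ob X 1 = X_2, ...; r X n : X_{n+2} → X_{n+1}.
record Obj : Set₁ where
  field
    Ob : ℕ → Set
    r  : ∀ n → Ob (suc n) → Ob n
open Obj public

restr : (X : Obj) {m n : ℕ} → m ≤′ n → Ob X n → Ob X m
restr X ≤′-refl x = x
restr X (≤′-step p) x = restr X p (r X _ x)

-- Global elements  Hom_S(1, A)  (1 is the terminal object, 1_n a singleton)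
record Glob (A : Obj) : Set where
  field
    el  : ∀ n → Ob A n
    nat : ∀ n → r A n (el (suc n)) ≡ el n
open Glob public

-- Equality of morphisms 1 → A in S: equality of the component functions
-- (extensional, as morphisms of S are natural families of functions).
_≈G_ : {A : Obj} → Glob A → Glob A → Set
x ≈G y = ∀ n → el x n ≡ el y n

Δ : Set → Obj
Δ S = record { Ob = λ _ → S ; r = λ _ x → x }

_×ₒ_ : Obj → Obj → Obj
X ×ₒ Y = record { Ob = λ n → Ob X n × Ob Y n
                ; r  = λ n p → r X n (proj₁ p) , r Y n (proj₂ p) }

■ : Obj → Obj
■ A = Δ (Glob A)

unbox : {A : Obj} → ∀ n → Ob (■ A) n → Ob A n
unbox n x = el x n

-- Subobjects / formulas in context X, given by their membership predicate
-- at each stage (for genuine subobjects this is the set of elements whose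
-- characteristic value is "true" = n).
Pred : Obj → Set₁
Pred X = ∀ n → Ob X n → Set

_⇒ₚ_ : {X : Obj} → Pred X → Pred X → Pred X
_⇒ₚ_ {X} P Q n x = ∀ m (p : m ≤′ n) → P m (restr X p x) → Q m (restr X p x)

data ℕ∞ : Set where
  fin : ℕ → ℕ∞
  ∞   : ℕ∞

ExtObj : (X : Obj) {m : ℕ} → Ob X m → ℕ → Set
ExtObj X {m} x k = Σ (m ≤′ k) λ p → Σ (Ob X k) λ y → restr X p y ≡ x

-- same, in the subobject Y of X (elements of Y identified with their image in X)
ExtSub : (X : Obj) → Pred X → {m : ℕ} → Ob X m → ℕ → Set
ExtSub X Y {m} x k =
  Σ (m ≤′ k) λ p → Σ (Ob X k) λ y → Y k y × restr X p y ≡ x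

IsHeight : (m : ℕ) → (ℕ → Set) → ℕ∞ → Set
IsHeight m E (fin k) = m ≤′ k × E k × (∀ j → k <′ j → ¬ E j)
IsHeight m E ∞       = ∀ j → m ≤′ j → E j

HeightsAgree : (X : Obj) → Pred X → {m : ℕ} → Ob X m → Set
HeightsAgree X Y {m} x =
  Σ ℕ∞ λ h → IsHeight m (ExtSub X Y x) h × IsHeight m (ExtObj X x) h

-- The "always" modality: χ_{□Y}(x) = χ_Y(x) if height_Y(x) = height_X(x), else 0.
-- Since "true" at a stage is never 0, x ∈ (□Y)_n iff x ∈ Y_n and heights agree.
□ : {X : Obj} → Pred X → Pred X
□ {X} Y n x = Y n x × HeightsAgree X Y x

Valid : {X : Obj} → Pred X → Set
Valid {X} P = ∀ n (x : Ob X n) → P n x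

Ctx : Obj → Obj
Ctx A = ■ A ×ₒ ■ A

-- [[ unbox x =_A unbox y ]] : pullback of the diagonal of [[A]] along ⟨unbox∘π₁, unbox∘π₂⟩
UnboxEq : (A : Obj) → Pred (Ctx A)
UnboxEq A n xy = unbox {A} n (proj₁ xy) ≡ unbox {A} n (proj₂ xy)

BoxEq : (A : Obj) → Pred (Ctx A)
BoxEq A n xy = proj₁ xy ≈G proj₂ xy

module Submission where

-- The context x, y : ■A denotes a constant object
-- Δ(Hom(1,A)) × Δ(Hom(1,A)), whose restriction maps are identities.  Hence
-- every element of a constant object extends to every later stage, i.e.
-- its height is ∞.  If x ∈ □Y for a subobject Y of a constant object, the
-- height of x in Y must therefore also be ∞: x lies in Y at every later
-- stage.  Applied to Y = [[unbox x = unbox y]] this says that the global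
-- elements x and y of A agree at all stages from some point on.  Finally,
-- global elements are compatible with restriction, so agreement at stage k
-- propagates down to every stage j ≤ k; thus x and y agree everywhere,
-- which is x =_{■A} y.

open import Defs
open import Data.Nat using (ℕ; suc; _+_; _≤′_; ≤′-refl; ≤′-step)
open import Data.Nat.Properties using (≤⇒≤′; m≤n+m; m≤m+n)
open import Data.Product using (_×_; _,_; proj₁; proj₂)
open import Data.Empty using (⊥-elim)
open import Relation.Nullary using (¬_)
open import Relation.Binary.PropositionalEquality
  using (_≡_; refl; sym; trans; cong; subst; module ≡-Reasoning)

restr-Δ : (S : Set) {m n : ℕ} (p : m ≤′ n) (x : S) → restr (Δ S) p x ≡ x
restr-Δ S ≤′-refl     x = refl
restr-Δ S (≤′-step p) x = restr-Δ S p x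

extends-Δ : (S : Set) {m : ℕ} (x : S) (k : ℕ) → m ≤′ k → ExtObj (Δ S) {m} x k
extends-Δ S x k p = p , x , restr-Δ S p x

no-finite-height : {m k : ℕ} {E : ℕ → Set} →
                   (∀ j → m ≤′ j → E j) → ¬ IsHeight m E (fin k)
no-finite-height {k = k} always (m≤k , _ , maximal) =
  maximal (suc k) ≤′-refl (always (suc k) (≤′-step m≤k))

-- In a constant object, x ∈ (□Y)_m means x ∈ Y_k for every k ≥ m:
-- the heights agree only if the height in Y is also ∞.
□-Δ : (S : Set) (Y : Pred (Δ S)) {m : ℕ} (x : S) →
      □ {Δ S} Y m x → ∀ k → m ≤′ k → Y k x
□-Δ S Y x (_ , fin _ , _ , heightX) _ _ =
  ⊥-elim (no-finite-height (extends-Δ S x) heightX)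
□-Δ S Y x (_ , ∞ , heightY , _) k m≤k with heightY k m≤k
... | p , y , y∈Y , py≡x = subst (Y k) (trans (sym (restr-Δ S p y)) py≡x) y∈Y

restr-glob : (A : Obj) (g : Glob A) {j k : ℕ} (p : j ≤′ k) →
             restr A p (el g k) ≡ el g j
restr-glob A g ≤′-refl = refl
restr-glob A g {j} {suc k} (≤′-step p) =
  trans (cong (restr A p) (nat g k)) (restr-glob A g p)

agree-below : (A : Obj) (x y : Glob A) {j k : ℕ} →
              j ≤′ k → el x k ≡ el y k → el x j ≡ el y j
agree-below A x y {j} {k} p eqₖ = begin
  el x j              ≡⟨ sym (restr-glob A x p) ⟩
  restr A p (el x k)  ≡⟨ cong (restr A p) eqₖ ⟩
  restr A p (el y k)  ≡⟨ restr-glob A y p ⟩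
  el y j              ∎
  where open ≡-Reasoning

eventually-agree : (A : Obj) (x y : Glob A) (m : ℕ) →
                   (∀ k → m ≤′ k → el x k ≡ el y k) → x ≈G y
eventually-agree A x y m agree j =
  agree-below A x y (≤⇒≤′ (m≤m+n j m)) (agree (j + m) (≤⇒≤′ (m≤n+m m j)))

lemma3p10 : (A : Obj) → Valid {Ctx A} (_⇒ₚ_ {Ctx A} (□ {Ctx A} (UnboxEq A)) (BoxEq A))
lemma3p10 A n xy m p always-eq =
  eventually-agree A (proj₁ xy′) (proj₂ xy′) m
    (□-Δ (Glob A × Glob A) (UnboxEq A) xy′ always-eq)
  where
    xy′ : Glob A × Glob A
    xy′ = restr (Ctx A) p xy
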